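{- Let $\mathcal{P}=(Q,\Sigma,\delta)$ be an ASMS with states $\mathit{init},\mathit{fin}\in Q$ and a letter $\#\in\Sigma$, and let $\mathcal{S}:=\mathit{post}^*(([\mathit{init}],\#))\cap\overline{\mathit{pre}^*(\uparrow\mathit{fin})}$. Then $\mathcal{P}$ has a positive cut-off if and only if $\mathcal{S}$ is finite.
   Context: An ASMS is $\mathcal{P}=(Q,\Sigma,\delta)$ with $\delta\subseteq Q\times\{R,W\}\times\Sigma\times Q$. A configuration is $(M,d)$ with $M$ a multiset over $Q$ and $d\in\Sigma$. A step $(M,d)\to(M',d')$ exists if there is $(p,\mathtt{op},d'',q)\in\delta$ with $M(p)>0$, $M'=M-\vec p+\vec q$, and either $\mathtt{op}=R$ and $d=d'=d''$, or $\mathtt{op}=W$ and $d'=d''$. $\mathit{post}^*$, $\mathit{pre}^*$ denote reachable successors/predecessors; $\overline{X}$ is the complement in the set of all configurations. $([\mathit{init}],\#)$ is the set of configurations $(M,\#)$ with $M(q)=0$ for all $q\ne\mathit{init}$ (any number of agents in $\mathit{init}$). $\uparrow\mathit{fin}$ is the set of configurations $(M,d)$ with $M(\mathit{fin})\ge1$. $(\langle\!\langle k\cdot\mathit{init}\rangle\!\rangle,\#)$ almost-surely covers $\mathit{fin}$ iff $\mathit{post}^*((\langle\!\langle k\cdot\mathit{init}\rangle\!\rangle,\#))\subseteq\mathit{pre}^*(\uparrow\mathit{fin})$; $k$ is a positive cut-off if for all $h\ge k$, $(\langle\!\langle h\cdot\mathit{init}\rangle\!\rangle,\#)$ almost-surely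 covers $\mathit{fin}$. -}

module Defs where

open import Data.Nat using (ℕ; zero; suc; pred; _≤_; _≥_)
open import Data.Fin using (Fin)
open import Data.Vec using (Vec; lookup; replicate; updateAt; _[_]≔_)
open import Data.List using (List)
open import Data.List.Membership.Propositional using (_∈_)
open import Data.Product using (_×_; _,_; Σ; ∃; ∃-syntax)
open import Relation.Binary.Construct.Closure.ReflexiveTransitive using (Star)
open import Relation.Binary.PropositionalEquality using (_≡_)
open import Relation.Nullary using (¬_)
open import Function.Bundles using (_⇔_)

data Op : Set where
  R W : Op

record ASMS (n m : ℕ) : Set where
  field
    δ : List (Fin n × Op × Fin m × Fin n)
open ASMS public

Multiset : ℕ → Set
Multiset n = Vec ℕ n

Config : ℕ → ℕ → Set
Config n m = Multiset n × Fin m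

ConfSet : ℕ → ℕ → Set₁
ConfSet n m = Config n m → Set

-- M - p + q  (used only when M(p) > 0)
move : ∀ {n} → Multiset n → Fin n → Fin n → Multiset n
move M p q = updateAt (updateAt M p pred) q suc

data Step {n m} (P : ASMS n m) : Config n m → Config n m → Set where
  read  : ∀ {M p d q} → (p , R , d , q) ∈ δ P → 1 ≤ lookup M p →
          Step P (M , d) (move M p q , d)
  write : ∀ {M p d d'' q} → (p , W , d'' , q) ∈ δ P → 1 ≤ lookup M p →
          Step P (M , d) (move M p q , d'')

Reach : ∀ {n m} → ASMS n m → Config n m → Config n m → Set
Reach P = Star (Step P)

post* : ∀ {n m} → ASMS n m → ConfSet n m → ConfSet n m
post* P X c = ∃[ c₀ ] (X c₀ × Reach P c₀ c)

pre* : ∀ {n m} → ASMS n m → ConfSet n m → ConfSet n m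
pre* P X c = ∃[ c₁ ] (X c₁ × Reach P c c₁)

∁ : ∀ {n m} → ConfSet n m → ConfSet n m
∁ X c = ¬ X c

_∩_ : ∀ {n m} → ConfSet n m → ConfSet n m → ConfSet n m
(X ∩ Y) c = X c × Y c

_⊆_ : ∀ {n m} → ConfSet n m → ConfSet n m → Set
X ⊆ Y = ∀ c → X c → Y c

-- ([init], #): M(q) = 0 for all q ≠ init, any number of agents in init.
InitConfs : ∀ {n m} → Fin n → Fin m → ConfSet n m
InitConfs init # (M , d) = (d ≡ #) × (∀ q → ¬ (q ≡ init) → lookup M q ≡ 0)

kInit : ∀ {n m} → ℕ → Fin n → Fin m → Config n m
kInit k init # = (replicate _ 0 [ init ]≔ k , #)

UpFin : ∀ {n m} → Fin n → ConfSet n m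
UpFin fin (M , d) = lookup M fin ≥ 1

⟦_⟧ : ∀ {n m} → Config n m → ConfSet n m
⟦ c ⟧ c' = c' ≡ c

AlmostSurelyCovers : ∀ {n m} → ASMS n m → Config n m → Fin n → Set
AlmostSurelyCovers P c fin = post* P ⟦ c ⟧ ⊆ pre* P (UpFin fin)

IsPositiveCutoff : ∀ {n m} → ASMS n m → Fin n → Fin n → Fin m → ℕ → Set
IsPositiveCutoff P init fin # k =
  (k ≥ 1) × (∀ h → h ≥ k → AlmostSurelyCovers P (kInit h init #) fin)

HasPositiveCutoff : ∀ {n m} → ASMS n m → Fin n → Fin n → Fin m → Set
HasPositiveCutoff P init fin # = ∃[ k ] IsPositiveCutoff P init fin # k

Finite : ∀ {n m} → ConfSet n m → Set
Finite {n} {m} X = Σ (List (Config n m)) (λ L → ∀ c → X c → c ∈ L)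

𝒮 : ∀ {n m} → ASMS n m → Fin n → Fin n → Fin m → ConfSet n m
𝒮 P init fin # = post* P (InitConfs init #) ∩ ∁ (pre* P (UpFin fin))

-- The size (number of agents) of a configuration never changes, and the initial
-- configuration of size h is ⟨⟨h·init⟩⟩. If k is a positive cut-off, every
-- configuration of 𝒮 is reached from some ⟨⟨h·init⟩⟩ with h < k, so it has size
-- below k, and there are finitely many such configurations. Conversely, if 𝒮 is
-- finite, every h above the sizes occurring in 𝒮 is a cut-off: a configuration
-- reachable from ⟨⟨h·init⟩⟩ has size h, so it lies outside 𝒮, i.e. in
-- pre*(↑fin). To conclude this constructively, membership in pre*(↑fin) must be
-- decidable: the configurations reachable from c all have the size of c, so
-- they are finitely many, and a loop-free path to ↑fin visits each at most once.
module Submission where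

open import Defs
open import Data.Fin using (Fin)
open import Function.Bundles using (_⇔_; mk⇔)

import Data.Fin as Fin
open import Data.Nat using (ℕ; zero; suc; pred; _+_; _≤_; _<_; _≥_; s≤s; z≤n; _≤?_; _<?_; _≟_)
open import Data.Nat.Properties
  using (≤-trans; ≤-reflexive; <⇒≤; n≤1+n; m≤m+n; m≤n+m; +-suc; +-identityʳ; <⇒≱; ≮⇒≥)
open import Data.Vec using (Vec; []; _∷_; lookup; replicate; updateAt; _[_]≔_; sum)
open import Data.Vec.Properties
  using (lookup∘update; lookup∘update′; lookup-replicate; tabulate∘lookup; tabulate-cong)
import Data.Vec.Properties as Vec
open import Data.List using (List; []; _∷_; [_]; length; filter; map; upTo; allFin; cartesianProduct; cartesianProductWith)
open import Data.List.Extrema.Nat using (max; xs≤max)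
open import Data.List.Properties using (filter-notAll)
open import Data.List.Relation.Unary.Any using (Any; here; there; any?)
import Data.List.Relation.Unary.Any as Any
import Data.List.Relation.Unary.All as All
open import Data.List.Relation.Unary.All using ([]; _∷_)
open import Data.List.Relation.Unary.All.Properties using (¬Any⇒All¬)
open import Data.List.Relation.Unary.AllPairs using ([]; _∷_)
open import Data.List.Relation.Unary.Unique.Propositional using (Unique)
open import Data.List.Membership.Propositional using (_∈_; lose; find)
open import Data.List.Membership.Propositional.Properties
  using (∈-filter⁺; ∈-map⁺; ∈-upTo⁺; ∈-allFin; ∈-cartesianProduct⁺; ∈-cartesianProductWith⁺)
import Data.List.Membership.DecPropositional as DecMembership
import Data.List.Relation.Binary.Subset.Propositional as List
import Data.Product.Properties as Product
open import Data.Product using (_×_; _,_; Σ; ∃-syntax; proj₁)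
open import Data.Sum using (_⊎_; inj₁; inj₂)
open import Level using (0ℓ)
open import Relation.Binary.Core using (Rel)
open import Relation.Binary.Definitions using (DecidableEquality)
open import Relation.Binary.Construct.Closure.ReflexiveTransitive using (Star; ε; _◅_)
open import Relation.Binary.PropositionalEquality using (_≡_; refl; sym; trans; cong; subst)
open import Relation.Nullary using (¬_; Dec; yes; no; ¬?; contradiction)
open import Relation.Nullary.Decidable using (map′; _×-dec_; _⊎-dec_; decidable-stable)
open import Relation.Unary using (Pred; Decidable)

unique⊆⇒length≤ : {A : Set} → DecidableEquality A → {xs ys : List A} →
                  Unique xs → xs List.⊆ ys → length xs ≤ length ys
unique⊆⇒length≤ _≟_ {[]} _ _ = z≤n
unique⊆⇒length≤ _≟_ {x ∷ xs} {ys} (x∉xs ∷ xs!) xs⊆ys =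
  ≤-trans (s≤s (unique⊆⇒length≤ _≟_ xs! xs⊆ys-x)) (filter-notAll ≠x? ys x∈ys)
  where
  ≠x? : Decidable (λ y → ¬ x ≡ y)
  ≠x? y = ¬? (x ≟ y)
  xs⊆ys-x : xs List.⊆ filter ≠x? ys
  xs⊆ys-x z∈xs = ∈-filter⁺ ≠x? (xs⊆ys (there z∈xs)) (All.lookup x∉xs z∈xs)
  x∈ys : Any (λ y → ¬ ¬ x ≡ y) ys
  x∈ys = Any.map (λ { refl x≢x → x≢x refl }) (xs⊆ys (here refl))

module Walks {A : Set} (_≟_ : DecidableEquality A) (_⟶_ : Rel A 0ℓ) where

  open DecMembership _≟_ using (_∈?_)

  vertices : ∀ {x y} → Star _⟶_ x y → List A
  vertices {x} ε       = [ x ]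
  vertices {x} (_ ◅ r) = x ∷ vertices r

  reach-vertex : ∀ {x y z} (r : Star _⟶_ x y) → z ∈ vertices r → Star _⟶_ x z
  reach-vertex ε       (here refl)  = ε
  reach-vertex (_ ◅ _) (here refl)  = ε
  reach-vertex (s ◅ r) (there z∈r) = s ◅ reach-vertex r z∈r

  walkFrom : ∀ {x y z} (r : Star _⟶_ x y) → z ∈ vertices r → Star _⟶_ z y
  walkFrom ε       (here refl)  = ε
  walkFrom (s ◅ r) (here refl)  = s ◅ r
  walkFrom (_ ◅ r) (there z∈r) = walkFrom r z∈r

  unique-walkFrom : ∀ {x y z} (r : Star _⟶_ x y) (z∈r : z ∈ vertices r) →
                    Unique (vertices r) → Unique (vertices (walkFrom r z∈r))
  unique-walkFrom ε       (here refl)  r!       = r!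
  unique-walkFrom (_ ◅ _) (here refl)  r!       = r!
  unique-walkFrom (_ ◅ r) (there z∈r) (_ ∷ r!) = unique-walkFrom r z∈r r!

  -- Loop erasure: a walk revisiting its start is cut at the later visit.
  loopless : ∀ {x y} → Star _⟶_ x y → Σ (Star _⟶_ x y) (λ r → Unique (vertices r))
  loopless ε = ε , [] ∷ []
  loopless {x} (s ◅ r) with loopless r
  ... | r′ , r′! with x ∈? vertices r′
  ...   | yes x∈r′ = walkFrom r′ x∈r′ , unique-walkFrom r′ x∈r′ r′!
  ...   | no  x∉r′ = s ◅ r′ , ¬Any⇒All¬ _ x∉r′ ∷ r′!

module FiniteReachability
  {A : Set} (_≟_ : DecidableEquality A) {_⟶_ : Rel A 0ℓ}
  (successor? : ∀ {Q : Pred A 0ℓ} → Decidable Q → Decidable (λ x → ∃[ y ] x ⟶ y × Q y))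
  {X : Pred A 0ℓ} (X? : Decidable X) where

  open Walks _≟_ _⟶_

  Reaches : Pred A 0ℓ
  Reaches x = ∃[ y ] X y × Star _⟶_ x y

  ReachesWithin : ℕ → Pred A 0ℓ
  ReachesWithin zero    x = X x
  ReachesWithin (suc j) x = X x ⊎ ∃[ y ] x ⟶ y × ReachesWithin j y

  reachesWithin? : ∀ j → Decidable (ReachesWithin j)
  reachesWithin? zero    = X?
  reachesWithin? (suc j) x = X? x ⊎-dec successor? (reachesWithin? j) x

  within⇒reaches : ∀ j {x} → ReachesWithin j x → Reaches x
  within⇒reaches zero    Xx               = _ , Xx , ε
  within⇒reaches (suc j) (inj₁ Xx)        = _ , Xx , ε
  within⇒reaches (suc j) (inj₂ (_ , s , w)) =
    let z , Xz , r = within⇒reaches j w in z , Xz , s ◅ r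

  walk⇒within : ∀ j {x y} (r : Star _⟶_ x y) → X y →
                length (vertices r) ≤ suc j → ReachesWithin j x
  walk⇒within zero    ε       Xy _            = Xy
  walk⇒within (suc j) ε       Xy _            = inj₁ Xy
  walk⇒within (suc j) (s ◅ r) Xy (s≤s |r|≤j) = inj₂ (_ , s , walk⇒within j r Xy |r|≤j)
  walk⇒within zero    (s ◅ ε)       _ (s≤s ())
  walk⇒within zero    (s ◅ (_ ◅ _)) _ (s≤s ())

  reaches⇒within : ∀ {x} (U : List A) → (∀ {y} → Star _⟶_ x y → y ∈ U) →
                   Reaches x → ReachesWithin (length U) x
  reaches⇒within U closed (y , Xy , r) =
    let r′ , r′! = loopless r in
    walk⇒within (length U) r′ Xy
      (≤-trans (unique⊆⇒length≤ _≟_ r′! (λ z∈r′ → closed (reach-vertex r′ z∈r′))) (n≤1+n _))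

  reaches? : ∀ x (U : List A) → (∀ {y} → Star _⟶_ x y → y ∈ U) → Dec (Reaches x)
  reaches? x U closed =
    map′ (within⇒reaches (length U)) (reaches⇒within U closed) (reachesWithin? (length U) x)

sum-updateAt-suc : ∀ {k} (xs : Vec ℕ k) i → sum (updateAt xs i suc) ≡ suc (sum xs)
sum-updateAt-suc (x ∷ xs) Fin.zero    = refl
sum-updateAt-suc (x ∷ xs) (Fin.suc i) = trans (cong (x +_) (sum-updateAt-suc xs i)) (+-suc x (sum xs))

sum-updateAt-pred : ∀ {k} (xs : Vec ℕ k) i → 1 ≤ lookup xs i → suc (sum (updateAt xs i pred)) ≡ sum xs
sum-updateAt-pred (suc x ∷ xs) Fin.zero    _ = refl
sum-updateAt-pred (x ∷ xs)     (Fin.suc i) xsᵢ≥1 =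
  trans (sym (+-suc x _)) (cong (x +_) (sum-updateAt-pred xs i xsᵢ≥1))

sum-move : ∀ {n} (M : Multiset n) p q → 1 ≤ lookup M p → sum (move M p q) ≡ sum M
sum-move M p q Mₚ≥1 = trans (sum-updateAt-suc (updateAt M p pred) q) (sum-updateAt-pred M p Mₚ≥1)

sum-replicate-0-[]≔ : ∀ {k} (i : Fin k) h → sum (replicate k 0 [ i ]≔ h) ≡ h
sum-replicate-0-[]≔ {suc k} Fin.zero    h = trans (cong (h +_) (sum-replicate-0 k)) (+-identityʳ h)
  where
  sum-replicate-0 : ∀ k → sum (replicate k 0) ≡ 0
  sum-replicate-0 zero    = refl
  sum-replicate-0 (suc k) = sum-replicate-0 k
sum-replicate-0-[]≔ {suc k} (Fin.suc i) h = sum-replicate-0-[]≔ i h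

lookup-extensionality : ∀ {A : Set} {k} {xs ys : Vec A k} → (∀ i → lookup xs i ≡ lookup ys i) → xs ≡ ys
lookup-extensionality {xs = xs} {ys} eq =
  trans (sym (tabulate∘lookup xs)) (trans (tabulate-cong eq) (tabulate∘lookup ys))

constant-outside⇒≡replicate-[]≔ : ∀ {A : Set} {k} (xs : Vec A k) (x : A) (i : Fin k) →
                                   (∀ j → ¬ j ≡ i → lookup xs j ≡ x) →
                                   xs ≡ replicate k x [ i ]≔ lookup xs i
constant-outside⇒≡replicate-[]≔ {k = k} xs x i xs≡x-off-i = lookup-extensionality lookups
  where
  lookups : ∀ j → lookup xs j ≡ lookup (replicate k x [ i ]≔ lookup xs i) j
  lookups j with j Fin.≟ i
  ... | yes refl = sym (lookup∘update j (replicate k x) (lookup xs j))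
  ... | no  j≢i  = trans (xs≡x-off-i j j≢i)
                     (sym (trans (lookup∘update′ j≢i (replicate k x) _) (lookup-replicate j x)))

vecsUpTo : ℕ → (k : ℕ) → List (Vec ℕ k)
vecsUpTo b zero    = [ [] ]
vecsUpTo b (suc k) = cartesianProductWith _∷_ (upTo (suc b)) (vecsUpTo b k)

∈-vecsUpTo : ∀ {k b} (xs : Vec ℕ k) → sum xs ≤ b → xs ∈ vecsUpTo b k
∈-vecsUpTo []       _ = here refl
∈-vecsUpTo (x ∷ xs) Σ≤b = ∈-cartesianProductWith⁺ _∷_
  (∈-upTo⁺ (s≤s (≤-trans (m≤m+n x (sum xs)) Σ≤b)))
  (∈-vecsUpTo xs (≤-trans (m≤n+m (sum xs) x) Σ≤b))

size : ∀ {n m} → Config n m → ℕ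
size (M , _) = sum M

size-kInit : ∀ {n m} h (init : Fin n) (# : Fin m) → size (kInit h init #) ≡ h
size-kInit h init _ = sum-replicate-0-[]≔ init h

kInit-initial : ∀ {n m} h (init : Fin n) (# : Fin m) → InitConfs init # (kInit h init #)
kInit-initial h init _ = refl , λ q q≢init →
  trans (lookup∘update′ q≢init (replicate _ 0) h) (lookup-replicate q 0)

initial⇒kInit : ∀ {n m} {init : Fin n} {# : Fin m} c → InitConfs init # c →
                c ≡ kInit (lookup (proj₁ c) init) init #
initial⇒kInit {init = init} (M , _) (refl , zero-off-init) = cong (_, _) (constant-outside⇒≡replicate-[]≔ M 0 init zero-off-init)

configsUpTo : ∀ {n m} → ℕ → List (Config n m)
configsUpTo {n} {m} b = cartesianProduct (vecsUpTo b n) (allFin m)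

∈-configsUpTo : ∀ {n m b} (c : Config n m) → size c ≤ b → c ∈ configsUpTo b
∈-configsUpTo (M , d) size≤b = ∈-cartesianProduct⁺ (∈-vecsUpTo M size≤b) (∈-allFin d)

_≟ᶜ_ : ∀ {n m} → DecidableEquality (Config n m)
_≟ᶜ_ = Product.≡-dec (Vec.≡-dec _≟_) Fin._≟_

module _ {n m : ℕ} (P : ASMS n m) where

  step-preserves-size : ∀ {c c′} → Step P c c′ → size c′ ≡ size c
  step-preserves-size (read  {M} {p} {q = q} _ Mₚ≥1) = sum-move M p q Mₚ≥1
  step-preserves-size (write {M} {p} {q = q} _ Mₚ≥1) = sum-move M p q Mₚ≥1

  reach-preserves-size : ∀ {c c′} → Reach P c c′ → size c′ ≡ size c
  reach-preserves-size ε       = refl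
  reach-preserves-size (s ◅ r) = trans (reach-preserves-size r) (step-preserves-size s)

  Transition : Set
  Transition = Fin n × Op × Fin m × Fin n

  Enabled : Transition → Config n m → Set
  Enabled (p , R , d′ , _) (M , d) = 1 ≤ lookup M p × d ≡ d′
  Enabled (p , W , _  , _) (M , _) = 1 ≤ lookup M p

  enabled? : ∀ t c → Dec (Enabled t c)
  enabled? (p , R , d′ , _) (M , d) = 1 ≤? lookup M p ×-dec d Fin.≟ d′
  enabled? (p , W , _  , _) (M , _) = 1 ≤? lookup M p

  fire : Transition → Config n m → Config n m
  fire (p , R , _  , q) (M , d) = move M p q , d
  fire (p , W , d′ , q) (M , _) = move M p q , d′

  fire-step : ∀ {t c} → t ∈ δ P → Enabled t c → Step P c (fire t c)
  fire-step {_ , R , _ , _} t∈δ (Mₚ≥1 , refl) = read  t∈δ Mₚ≥1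
  fire-step {_ , W , _ , _} t∈δ Mₚ≥1          = write t∈δ Mₚ≥1

  step-fires : ∀ {c c′} → Step P c c′ → Any (λ t → Enabled t c × fire t c ≡ c′) (δ P)
  step-fires (read  t∈δ Mₚ≥1) = lose t∈δ ((Mₚ≥1 , refl) , refl)
  step-fires (write t∈δ Mₚ≥1) = lose t∈δ (Mₚ≥1 , refl)

  successor? : ∀ {Q : Pred (Config n m) 0ℓ} → Decidable Q →
               Decidable (λ c → ∃[ c′ ] Step P c c′ × Q c′)
  successor? {Q} Q? c = map′ fromAny toAny (any? (λ t → enabled? t c ×-dec Q? (fire t c)) (δ P))
    where
    fromAny : Any (λ t → Enabled t c × Q (fire t c)) (δ P) → ∃[ c′ ] Step P c c′ × Q c′
    fromAny any = let t , t∈δ , en , Qc′ = find any in fire t c , fire-step t∈δ en , Qc′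
    toAny : ∃[ c′ ] Step P c c′ × Q c′ → Any (λ t → Enabled t c × Q (fire t c)) (δ P)
    toAny (_ , s , Qc′) = Any.map (λ { (en , eq) → en , subst Q (sym eq) Qc′ }) (step-fires s)

  pre*-UpFin? : ∀ fin c → Dec (pre* P (UpFin fin) c)
  pre*-UpFin? fin c = reaches? c (configsUpTo (size c))
    (λ r → ∈-configsUpTo _ (≤-reflexive (reach-preserves-size r)))
    where open FiniteReachability _≟ᶜ_ successor? {UpFin fin} (λ (M , _) → 1 ≤? lookup M fin)

module _ {n m : ℕ} (P : ASMS n m) (init fin : Fin n) (# : Fin m) where

  cutoff⇒finite-𝒮 : HasPositiveCutoff P init fin # → Finite (𝒮 P init fin #)
  cutoff⇒finite-𝒮 (k , _ , covers) = configsUpTo k , 𝒮⊆configsUpTo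
    where
    𝒮⊆configsUpTo : ∀ c → 𝒮 P init fin # c → c ∈ configsUpTo k
    𝒮⊆configsUpTo c ((c₀ , c₀-initial , r) , c∉pre*)
      with c₀≡kInit ← initial⇒kInit c₀ c₀-initial | lookup (proj₁ c₀) init <? k
    ... | no  h≮k = contradiction (covers _ (≮⇒≥ h≮k) c (c₀ , c₀≡kInit , r)) c∉pre*
    ... | yes h<k = ∈-configsUpTo c (<⇒≤ (subst (_< k) h≡size-c h<k))
      where
      h≡size-c : lookup (proj₁ c₀) init ≡ size c
      h≡size-c = sym (trans (reach-preserves-size P r) (trans (cong size c₀≡kInit) (size-kInit _ init #)))

  finite-𝒮⇒cutoff : Finite (𝒮 P init fin #) → HasPositiveCutoff P init fin #
  finite-𝒮⇒cutoff (L , 𝒮⊆L) = suc (max 0 (map size L)) , s≤s z≤n , covers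
    where
    covers : ∀ h → h ≥ suc (max 0 (map size L)) → AlmostSurelyCovers P (kInit h init #) fin
    covers h h>max c (_ , refl , r) = decidable-stable (pre*-UpFin? P fin c) λ c∉pre* →
      let c∈L = 𝒮⊆L c ((_ , kInit-initial h init # , r) , c∉pre*)
          size-c≤max = All.lookup (xs≤max 0 (map size L)) (∈-map⁺ size c∈L)
      in <⇒≱ h>max (subst (_≤ _) (trans (reach-preserves-size P r) (size-kInit h init #)) size-c≤max)

theorem12 : ∀ {n m} (P : ASMS n m) (init fin : Fin n) (# : Fin m) →
    HasPositiveCutoff P init fin # ⇔ Finite (𝒮 P init fin #)
theorem12 P init fin # = mk⇔ (cutoff⇒finite-𝒮 P init fin #) (finite-𝒮⇒cutoff P init fin #)
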